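{- Let $(V,\Delta)$ be a BPP with $V=\{X_1,\dots,X_n\}$, let $\varphi$ be an EG-formula, let $s\in\mathbb{N}^n$ be a BPP state, and let $k$ be a natural number. Then: (i) (Termination) the recursive construction of $\mathit{Trans}(\varphi,s,k)$ terminates after finitely many steps; (ii) (Reliability) if $s\models_k\varphi$ then the closed linear integer arithmetic formula $\mathit{Trans}(\varphi,s,k)$ is true over $\mathbb{Z}$; (iii) (Soundness) if $\mathit{Trans}(\varphi,s,k)$ is true over $\mathbb{Z}$ then $s\models_k\varphi$.
   Context: A BPP is a pair $(V,\Delta)$ with $V=\{X_1,\dots,X_n\}$ finite and $\Delta$ a finite set of labelled rules $X\xrightarrow{a}\alpha$, $X\in V$, $a$ an action, $\alpha\in V^{\oplus}$ a finite multiset of symbols; states are multisets over $V$, identified with Parikh vectors in $\mathbb{N}^n$. A rule $X\xrightarrow{a}\alpha$ induces transitions $\beta X\gamma\xrightarrow{a}\beta\alpha\gamma$ (multiset union). For $r=X\xrightarrow{a}\alpha$ write ${}^{\bullet}r=X$, $r^{\bullet}=\alpha$, $r^{act}=a$; for a vector $s$, $s({}^{\bullet}r)=s_i$ where ${}^{\bullet}r=X_i$. Let $P^{ - }({}^{\bullet}r,r^{\bullet})_i=r^{\bullet}(X_i)-1$ if $X_i={}^{\bullet}r$ and $=r^{\bullet}(X_i)$ otherwise; $T^{ - }(s,t,r):=\bigwedge_{i}(s_i+P^{ - }({}^{\bullet}r,r^{\bullet})_i=t_i)$; $T(s,t,a):=\bigvee_{r\in\Delta}(r^{act}=a\wedge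 s({}^{\bullet}r)\ge1\wedge T^{ - }(s,t,r))$; $\mathit{Path}(u(0),\dots,u(k)):=\bigwedge_{j=1}^k\bigvee_{r\in\Delta}(u(j-1)({}^{\bullet}r)\ge1\wedge T^{ - }(u(j-1),u(j),r))$. EG-formulas: $\varphi::=\mathbf{a}\mathbf{m}^T\ge b\mid\neg\varphi\mid\varphi\wedge\varphi\mid\mathbf{E}\langle a\rangle\varphi\mid\mathbf{EG}\varphi$ with $\mathbf{m}=(X_1,\dots,X_n)$, $\mathbf{a}\in\mathbb{N}^n$, $b\in\mathbb{N}$. $\mathit{Trans}(\varphi,s,k)$ is defined recursively with fresh integer variables: atom $\mapsto \mathbf{a}s^T\ge b$; $\neg\varphi_1\mapsto\neg\mathit{Trans}(\varphi_1,s,k)$; $\varphi_1\wedge\varphi_2\mapsto$ conjunction of translations; $\mathbf{E}\langle a\rangle\varphi_1\mapsto k\ge1\wedge\exists t_1\cdots t_n.(T(s,t,a)\wedge\mathit{Trans}(\varphi_1,t,k))$; $\mathbf{EG}\varphi_1\mapsto\exists u(0)_1\cdots u(k)_n.\,\mathit{Path}(u(0),\dots,u(k))\wedge\bigwedge_i u(0)_i=s_i\wedge\bigwedge_{j=0}^k\mathit{Trans}(\varphi_1,u(j),k)$. The $k$-step bounded semantics: $s\models_k\mathbf{a}\mathbf{m}^T\ge b$ iff $\mathbf{a}s^T\ge b$; $s\models_k\neg\varphi$ iff not $s\models_k\varphi$; $s\models_k\varphi_1\wedge\varphi_2$ iff both hold; $s\models_k\mathbf{E}\langle a\rangle\varphi$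 iff $k\ge1$ and there is a state $t$ with $s\xrightarrow{a}t$ and $t\models_k\varphi$; $s\models_k\mathbf{EG}\varphi$ iff there are states $\pi(0)=s,\pi(1),\dots,\pi(k)$ with $\pi(j-1)\xrightarrow{b_j}\pi(j)$ for some actions $b_j$ ($1\le j\le k$) and $\pi(i)\models_k\varphi$ for all $0\le i\le k$. -}

module Defs where

open import Data.Nat as ℕ using (ℕ; zero; suc; _+_; _*_; _∸_; _≤_; _≡ᵇ_)
open import Data.Integer as ℤ using (ℤ; +_)
open import Data.Fin using (Fin; zero; suc; toℕ; inject₁; _≟_)
open import Data.Vec as Vec using (Vec; lookup; tabulate)
open import Data.List as List using (List; []; _∷_; upTo)
open import Data.List.Membership.Propositional using (_∈_)
open import Data.Bool using (if_then_else_)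
open import Data.Unit using (⊤)
open import Data.Empty using (⊥)
open import Data.Product using (Σ; ∃; _×_)
open import Data.Sum using (_⊎_)
open import Relation.Nullary using (¬_; does)
open import Relation.Binary.PropositionalEquality using (_≡_)

infixl 6 _⊕_
infixl 7 _⊛_

data Term : Set where
  lit : ℤ → Term
  var : ℕ → Term
  _⊕_ : Term → Term → Term
  _⊛_ : ℤ → Term → Term

Env : Set
Env = ℕ → ℤ

⟦_⟧t : Term → Env → ℤ
⟦ lit z ⟧t ρ = z
⟦ var x ⟧t ρ = ρ x
⟦ t ⊕ u ⟧t ρ = ⟦ t ⟧t ρ ℤ.+ ⟦ u ⟧t ρ
⟦ c ⊛ t ⟧t ρ = c ℤ.* ⟦ t ⟧t ρ

data LIA : Set where
  ⊤' ⊥' : LIA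
  _≥'_ : Term → Term → LIA
  _≐_ : Term → Term → LIA
  ¬'_ : LIA → LIA
  _∧'_ _∨'_ : LIA → LIA → LIA
  ∃'_·_ : ℕ → LIA → LIA

_[_≔_] : Env → ℕ → ℤ → Env
(ρ [ x ≔ z ]) y = if y ≡ᵇ x then z else ρ y

⟦_⟧ : LIA → Env → Set
⟦ ⊤' ⟧ ρ = ⊤
⟦ ⊥' ⟧ ρ = ⊥
⟦ t ≥' u ⟧ ρ = ⟦ u ⟧t ρ ℤ.≤ ⟦ t ⟧t ρ
⟦ t ≐ u ⟧ ρ = ⟦ t ⟧t ρ ≡ ⟦ u ⟧t ρ
⟦ ¬' F ⟧ ρ = ¬ ⟦ F ⟧ ρ
⟦ F ∧' G ⟧ ρ = ⟦ F ⟧ ρ × ⟦ G ⟧ ρ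
⟦ F ∨' G ⟧ ρ = ⟦ F ⟧ ρ ⊎ ⟦ G ⟧ ρ
⟦ ∃' x · F ⟧ ρ = Σ ℤ (λ z → ⟦ F ⟧ (ρ [ x ≔ z ]))

-- the environment used to evaluate closed formulas (irrelevant for them)
ρ₀ : Env
ρ₀ _ = + 0

⋀ : ∀ {m} → (Fin m → LIA) → LIA
⋀ {zero} f = ⊤'
⋀ {suc m} f = f zero ∧' ⋀ (λ i → f (suc i))

⋁L : ∀ {A : Set} → List A → (A → LIA) → LIA
⋁L [] f = ⊥'
⋁L (x ∷ xs) f = f x ∨' ⋁L xs f

∃* : List ℕ → LIA → LIA
∃* [] F = F
∃* (x ∷ xs) F = ∃' x · ∃* xs F

sumT : ∀ {m} → Vec Term m → Term
sumT Vec.[] = lit (+ 0)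
sumT (t Vec.∷ ts) = t ⊕ sumT ts

record Rule (n : ℕ) : Set where
  constructor _─[_]→_
  field
    src : Fin n
    act : ℕ
    tgt : Vec ℕ n        -- r• as a Parikh vector
open Rule public

BPP : ℕ → Set
BPP n = List (Rule n)

State : ℕ → Set
State n = Vec ℕ n

δ : ∀ {n} → Fin n → Fin n → ℕ
δ i j = if does (i ≟ j) then 1 else 0

Step : ∀ {n} → BPP n → State n → ℕ → State n → Set
Step Δ s a t = ∃ λ r → r ∈ Δ × act r ≡ a × 1 ≤ lookup s (src r)
  × t ≡ tabulate (λ i → (lookup s i ∸ δ (src r) i) + lookup (tgt r) i)

infixr 6 _∧ᴱ_
data EGForm (n : ℕ) : Set where
  atom : Vec ℕ n → ℕ → EGForm n
  ¬ᴱ_ : EGForm n → EGForm n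
  _∧ᴱ_ : EGForm n → EGForm n → EGForm n
  E⟨_⟩_ : ℕ → EGForm n → EGForm n
  EG_ : EGForm n → EGForm n

dotℕ : ∀ {n} → Vec ℕ n → Vec ℕ n → ℕ
dotℕ a s = Vec.foldr _ _+_ 0 (Vec.zipWith _*_ a s)

Sat : ∀ {n} → BPP n → ℕ → State n → EGForm n → Set
Sat Δ k s (atom a b) = b ≤ dotℕ a s
Sat Δ k s (¬ᴱ φ) = ¬ Sat Δ k s φ
Sat Δ k s (φ ∧ᴱ ψ) = Sat Δ k s φ × Sat Δ k s ψ
Sat Δ k s (E⟨ a ⟩ φ) = 1 ≤ k × ∃ λ t → Step Δ s a t × Sat Δ k t φ
Sat {n} Δ k s (EG φ) = Σ (Fin (suc k) → State n) λ π →
  π zero ≡ s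
  × (∀ (j : Fin k) → ∃ λ b → Step Δ (π (inject₁ j)) b (π (suc j)))
  × (∀ (i : Fin (suc k)) → Sat Δ k (π i) φ)

-- The translation Trans(φ, s, k); s is a vector of terms,
-- c is the index of the next fresh variable.

P⁻ : ∀ {n} → Rule n → Fin n → ℤ
P⁻ r i = + lookup (tgt r) i ℤ.- + δ (src r) i

T⁻ : ∀ {n} → Vec Term n → Vec Term n → Rule n → LIA
T⁻ s t r = ⋀ (λ i → (lookup s i ⊕ lit (P⁻ r i)) ≐ lookup t i)

enabled : ∀ {n} → Vec Term n → Rule n → LIA
enabled s r = lookup s (src r) ≥' lit (+ 1)

actIs : ∀ {n} → Rule n → ℕ → LIA
actIs r a = if act r ≡ᵇ a then ⊤' else ⊥'

T : ∀ {n} → BPP n → Vec Term n → Vec Term n → ℕ → LIA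
T Δ s t a = ⋁L Δ (λ r → actIs r a ∧' (enabled s r ∧' T⁻ s t r))

Path : ∀ {n k} → BPP n → (Fin (suc k) → Vec Term n) → LIA
Path {k = k} Δ u =
  ⋀ {k} (λ j → ⋁L Δ (λ r → enabled (u (inject₁ j)) r ∧' T⁻ (u (inject₁ j)) (u (suc j)) r))

Trans : ∀ {n} → BPP n → EGForm n → Vec Term n → ℕ → ℕ → LIA
Trans Δ (atom a b) s k c =
  sumT (tabulate (λ i → (+ lookup a i) ⊛ lookup s i)) ≥' lit (+ b)
Trans Δ (¬ᴱ φ) s k c = ¬' Trans Δ φ s k c
Trans Δ (φ ∧ᴱ ψ) s k c = Trans Δ φ s k c ∧' Trans Δ ψ s k c
Trans {n} Δ (E⟨ a ⟩ φ) s k c =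
  (lit (+ k) ≥' lit (+ 1)) ∧'
  ∃* (List.map (λ x → c + x) (upTo n))
     (T Δ s t a ∧' Trans Δ φ t k (c + n))
  where
  t : Vec Term n
  t = tabulate (λ i → var (c + toℕ i))
Trans {n} Δ (EG φ) s k c =
  ∃* (List.map (λ x → c + x) (upTo (suc k * n)))
     (Path Δ u
       ∧' (⋀ (λ i → lookup (u zero) i ≐ lookup s i)
       ∧' ⋀ {suc k} (λ j → Trans Δ φ (u j) k (c + suc k * n))))
  where
  u : Fin (suc k) → Vec Term n
  u j = tabulate (λ i → var (c + (toℕ j * n + toℕ i)))

const : ∀ {n} → State n → Vec Term n
const s = Vec.map (λ x → lit (+ x)) s

-- Induction on φ, generalised from the constant vector of s to any term vector denoting
-- the state under every environment that agrees with the current one below the next fresh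
-- variable. The conjunction T⁻ s t r holds exactly when t denotes the successor of the state
-- of s under r, so values for a block of fresh variables satisfying the translation are the
-- same thing as a successor state (E⟨a⟩) or a path laid out layer by layer (EG); in the
-- latter each layer is forced by the previous one, so the path is read off by induction
-- along it. Termination of Trans is structural recursion on φ, checked by Agda.
module Submission where

open import Defs
open import Data.Nat as ℕ using (ℕ; zero; suc; _+_; _*_; _∸_; _≤_; _<_; _≡ᵇ_; z≤n)
open import Data.Nat.Properties as ℕP using (≡ᵇ⇒≡; ≡⇒≡ᵇ)
open import Data.Integer as ℤ using (ℤ; +_; ∣_∣)
import Data.Integer.Properties as ℤP
open import Data.Fin using (Fin; zero; suc; toℕ; inject₁; combine; _≟_)
open import Data.Fin.Properties using (toℕ<n; toℕ-combine)
open import Data.Fin.Induction using (<-weakInduction)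
open import Data.Vec as Vec using (Vec; []; _∷_; lookup; tabulate; concat)
open import Data.Vec.Properties
  using (lookup∘tabulate; tabulate∘lookup; tabulate-cong; lookup-map; lookup-concat)
open import Data.List as List using (List; upTo; _∷_)
open import Data.List.Properties using (map-upTo; map-∘; map-cong)
open import Data.List.Membership.Propositional using (_∈_)
open import Data.List.Relation.Unary.Any using (here; there)
open import Data.Bool using (true; false)
open import Data.Unit using (tt)
open import Data.Empty using (⊥-elim)
open import Data.Product using (∃; ∃₂; _×_; _,_; proj₂)
open import Data.Product.Function.NonDependent.Propositional using (_×-⇔_)
open import Data.Sum using (inj₁; inj₂)
open import Function.Bundles using (_⇔_; mk⇔; module Equivalence)
open Equivalence using (to; from)
open import Function.Related.TypeIsomorphisms using (¬-cong-⇔)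
open import Relation.Nullary using (yes; no)
open import Relation.Binary.PropositionalEquality

⋀-intro : ∀ {m} (f : Fin m → LIA) {ρ} → (∀ i → ⟦ f i ⟧ ρ) → ⟦ ⋀ f ⟧ ρ
⋀-intro {zero}  f h = tt
⋀-intro {suc m} f h = h zero , ⋀-intro (λ i → f (suc i)) (λ i → h (suc i))

⋀-elim : ∀ {m} (f : Fin m → LIA) {ρ} → ⟦ ⋀ f ⟧ ρ → ∀ i → ⟦ f i ⟧ ρ
⋀-elim f (p , q) zero    = p
⋀-elim f (p , q) (suc i) = ⋀-elim (λ i → f (suc i)) q i

⋁L-intro : ∀ {A : Set} (xs : List A) (f : A → LIA) {ρ x} → x ∈ xs → ⟦ f x ⟧ ρ → ⟦ ⋁L xs f ⟧ ρ
⋁L-intro (x ∷ xs) f (here refl) p = inj₁ p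
⋁L-intro (x ∷ xs) f (there x∈) p  = inj₂ (⋁L-intro xs f x∈ p)

⋁L-elim : ∀ {A : Set} (xs : List A) (f : A → LIA) {ρ} → ⟦ ⋁L xs f ⟧ ρ → ∃ λ x → x ∈ xs × ⟦ f x ⟧ ρ
⋁L-elim (x ∷ xs) f (inj₁ p) = x , here refl , p
⋁L-elim (x ∷ xs) f (inj₂ p) with ⋁L-elim xs f p
... | y , y∈ , q = y , there y∈ , q

update-≡ : ∀ ρ x z → (ρ [ x ≔ z ]) x ≡ z
update-≡ ρ x z with x ≡ᵇ x | ≡⇒≡ᵇ x x refl
... | true | _ = refl

update-≢ : ∀ ρ {x y} z → y ≢ x → (ρ [ x ≔ z ]) y ≡ ρ y
update-≢ ρ {x} {y} z y≢x with y ≡ᵇ x | ≡ᵇ⇒≡ y x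
... | true  | y≡x = ⊥-elim (y≢x (y≡x tt))
... | false | _   = refl

AgreeBelow : ℕ → Env → Env → Set
AgreeBelow c ρ ρ' = ∀ {y} → y < c → ρ' y ≡ ρ y

block : ℕ → ℕ → List ℕ
block c m = List.map (λ x → c + x) (upTo m)

block-suc : ∀ c m → block c (suc m) ≡ c ∷ block (suc c) m
block-suc c m = cong₂ _∷_ (ℕP.+-identityʳ c) (begin
    List.map (λ x → c + x) (List.applyUpTo suc m)   ≡⟨ cong (List.map _) (map-upTo suc m) ⟨
    List.map (λ x → c + x) (List.map suc (upTo m))  ≡⟨ map-∘ (upTo m) ⟨
    List.map (λ x → c + suc x) (upTo m)             ≡⟨ map-cong (ℕP.+-suc c) (upTo m) ⟩
    List.map (λ x → suc c + x) (upTo m)             ∎)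
  where open ≡-Reasoning

assign : ∀ {m} → Env → ℕ → Vec ℕ m → Env
assign ρ c []      = ρ
assign ρ c (x ∷ w) = assign (ρ [ c ≔ + x ]) (suc c) w

assign-below : ∀ {m} ρ c (w : Vec ℕ m) → AgreeBelow c ρ (assign ρ c w)
assign-below ρ c []      y<c = refl
assign-below ρ c (x ∷ w) y<c =
  trans (assign-below _ (suc c) w (ℕP.m<n⇒m<1+n y<c)) (update-≢ ρ (+ x) (ℕP.<⇒≢ y<c))

assign-lookup : ∀ {m} ρ c (w : Vec ℕ m) i → assign ρ c w (c + toℕ i) ≡ + lookup w i
assign-lookup ρ c (x ∷ w) zero = begin
  assign (ρ [ c ≔ + x ]) (suc c) w (c + 0)  ≡⟨ cong (assign _ (suc c) w) (ℕP.+-identityʳ c) ⟩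
  assign (ρ [ c ≔ + x ]) (suc c) w c        ≡⟨ assign-below _ (suc c) w (ℕP.n<1+n c) ⟩
  (ρ [ c ≔ + x ]) c                        ≡⟨ update-≡ ρ c (+ x) ⟩
  + x                                      ∎
  where open ≡-Reasoning
assign-lookup ρ c (x ∷ w) (suc i) =
  trans (cong (assign _ (suc c) w) (ℕP.+-suc c (toℕ i))) (assign-lookup _ (suc c) w i)

∃*-block-intro : ∀ {m} c (w : Vec ℕ m) F {ρ} → ⟦ F ⟧ (assign ρ c w) → ⟦ ∃* (block c m) F ⟧ ρ
∃*-block-intro c []      F p = p
∃*-block-intro {suc m} c (x ∷ w) F {ρ} p =
  subst (λ xs → ⟦ ∃* xs F ⟧ ρ) (sym (block-suc c m)) (+ x , ∃*-block-intro (suc c) w F p)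

∃*-block-elim : ∀ c m F {ρ} → ⟦ ∃* (block c m) F ⟧ ρ → ∃ λ ρ' → AgreeBelow c ρ ρ' × ⟦ F ⟧ ρ'
∃*-block-elim c zero    F {ρ} p = ρ , (λ _ → refl) , p
∃*-block-elim c (suc m) F {ρ} p with subst (λ xs → ⟦ ∃* xs F ⟧ ρ) (block-suc c m) p
... | z , q with ∃*-block-elim (suc c) m F q
...   | ρ' , agree , r =
  ρ' , (λ y<c → trans (agree (ℕP.m<n⇒m<1+n y<c)) (update-≢ ρ z (ℕP.<⇒≢ y<c))) , r

record Denotes {n} (ρ : Env) (s : Vec Term n) (σ : State n) : Set where
  constructor denotes
  field value : ∀ i → ⟦ lookup s i ⟧t ρ ≡ + lookup σ i
open Denotes

-- The induction invariant of the translation: semantically, every variable of s is below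
-- the next fresh variable c.
StablyDenotes : ∀ {n} → ℕ → Env → Vec Term n → State n → Set
StablyDenotes c ρ s σ = ∀ {ρ'} → AgreeBelow c ρ ρ' → Denotes ρ' s σ

valueOf : ∀ {n} → Env → Vec Term n → State n
valueOf ρ t = tabulate (λ i → ∣ ⟦ lookup t i ⟧t ρ ∣)

denotes⇒≡valueOf : ∀ {n ρ} {t : Vec Term n} {τ} → Denotes ρ t τ → τ ≡ valueOf ρ t
denotes⇒≡valueOf {τ = τ} d =
  trans (sym (tabulate∘lookup τ)) (tabulate-cong (λ i → cong ∣_∣ (sym (value d i))))

denotes-valueOf : ∀ {n ρ} {t : Vec Term n} {τ} → Denotes ρ t τ → Denotes ρ t (valueOf ρ t)
denotes-valueOf d = subst (Denotes _ _) (denotes⇒≡valueOf d) d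

const-denotes : ∀ {n} (σ : State n) {ρ} → StablyDenotes 0 ρ (const σ) σ
const-denotes σ {ρ' = ρ'} _ = denotes λ i →
  cong (λ t → ⟦ t ⟧t ρ') (lookup-map i (λ x → lit (+ x)) σ)

vars : ∀ {n} → (Fin n → ℕ) → Vec Term n
vars idx = tabulate (λ i → var (idx i))

denotes-vars : ∀ {n ρ} (idx : Fin n → ℕ) {τ} → (∀ i → ρ (idx i) ≡ + lookup τ i)
  → Denotes ρ (vars idx) τ
denotes-vars {ρ = ρ} idx h = denotes λ i → trans (cong (λ t → ⟦ t ⟧t ρ) (lookup∘tabulate _ i)) (h i)

vars-stable : ∀ {n c ρ} (idx : Fin n → ℕ) {τ} → (∀ i → idx i < c)
  → Denotes ρ (vars idx) τ → StablyDenotes c ρ (vars idx) τ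
vars-stable {ρ = ρ} idx bound d {ρ'} agree = denotes-vars idx λ i →
  trans (agree (bound i)) (trans (sym (cong (λ t → ⟦ t ⟧t ρ) (lookup∘tabulate _ i))) (value d i))

dot-denotes : ∀ {n ρ} (a : Vec ℕ n) {s σ} → Denotes ρ s σ
  → ⟦ sumT (tabulate (λ i → (+ lookup a i) ⊛ lookup s i)) ⟧t ρ ≡ + dotℕ a σ
dot-denotes []      {[]}    {[]}    _ = refl
dot-denotes (x ∷ a) {_ ∷ s} {y ∷ σ} (denotes d) = begin
  _                           ≡⟨ cong₂ ℤ._+_ (cong (ℤ._*_ (+ x)) (d zero))
                                             (dot-denotes a {s} (denotes λ i → d (suc i))) ⟩
  + x ℤ.* + y ℤ.+ + dotℕ a σ  ≡⟨ cong (λ z → z ℤ.+ + dotℕ a σ) (ℤP.pos-* x y) ⟨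
  + (x * y) ℤ.+ + dotℕ a σ    ≡⟨ ℤP.pos-+ (x * y) (dotℕ a σ) ⟨
  + (x * y + dotℕ a σ)        ∎
  where open ≡-Reasoning

atom-correct : ∀ {n} (Δ : BPP n) k a b c {ρ s σ} → StablyDenotes c ρ s σ
  → Sat Δ k σ (atom a b) ⇔ ⟦ Trans Δ (atom a b) s k c ⟧ ρ
atom-correct Δ k a b c {ρ} G = mk⇔
  (λ b≤ → subst (ℤ._≤_ (+ b)) (sym dot) (ℤ.+≤+ b≤))
  (λ b≤ → ℤP.drop‿+≤+ (subst (ℤ._≤_ (+ b)) dot b≤))
  where dot = dot-denotes a (G {ρ} (λ _ → refl))

fire : ∀ {n} → Rule n → State n → State n
fire r σ = tabulate (λ i → (lookup σ i ∸ δ (src r) i) + lookup (tgt r) i)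

δ-≤ : ∀ {n} (σ : State n) {x} i → 1 ≤ lookup σ x → δ x i ≤ lookup σ i
δ-≤ σ {x} i p with x ≟ i
... | yes refl = p
... | no  _    = z≤n

+-P⁻≡fire : ∀ {n} (r : Rule n) (σ : State n) i → 1 ≤ lookup σ (src r)
  → + lookup σ i ℤ.+ P⁻ r i ≡ + lookup (fire r σ) i
+-P⁻≡fire r σ i en = begin
  + m ℤ.+ (+ g ℤ.- + d)      ≡⟨ cong (ℤ._+_ (+ m)) (ℤP.+-comm (+ g) (ℤ.- + d)) ⟩
  + m ℤ.+ (ℤ.- + d ℤ.+ + g)  ≡⟨ ℤP.+-assoc (+ m) (ℤ.- + d) (+ g) ⟨
  (+ m ℤ.- + d) ℤ.+ + g      ≡⟨ cong (λ z → z ℤ.+ + g) (ℤP.m-n≡m⊖n m d) ⟩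
  (m ℤ.⊖ d) ℤ.+ + g          ≡⟨ cong (λ z → z ℤ.+ + g) (ℤP.⊖-≥ (δ-≤ σ i en)) ⟩
  + (m ∸ d) ℤ.+ + g          ≡⟨ ℤP.pos-+ (m ∸ d) g ⟨
  + (m ∸ d + g)              ≡⟨ cong +_ (lookup∘tabulate _ i) ⟨
  + lookup (fire r σ) i      ∎
  where
  open ≡-Reasoning
  m = lookup σ i
  g = lookup (tgt r) i
  d = δ (src r) i

fires-complete : ∀ {n ρ} (r : Rule n) {s t σ} → Denotes ρ s σ → Denotes ρ t (fire r σ)
  → 1 ≤ lookup σ (src r) → ⟦ enabled s r ∧' T⁻ s t r ⟧ ρ
fires-complete r {σ = σ} (denotes ds) (denotes dt) en =
  subst (ℤ._≤_ (+ 1)) (sym (ds (src r))) (ℤ.+≤+ en) ,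
  ⋀-intro _ λ i → trans (cong (λ z → z ℤ.+ P⁻ r i) (ds i)) (trans (+-P⁻≡fire r σ i en) (sym (dt i)))

fires-sound : ∀ {n ρ} (r : Rule n) {s t σ} → Denotes ρ s σ → ⟦ enabled s r ∧' T⁻ s t r ⟧ ρ
  → 1 ≤ lookup σ (src r) × Denotes ρ t (fire r σ)
fires-sound r {σ = σ} (denotes ds) (en , eqs) = en' , denotes λ i →
  trans (sym (⋀-elim _ eqs i)) (trans (cong (λ z → z ℤ.+ P⁻ r i) (ds i)) (+-P⁻≡fire r σ i en'))
  where en' = ℤP.drop‿+≤+ (subst (ℤ._≤_ (+ 1)) (ds (src r)) en)

actIs-intro : ∀ {n ρ} (r : Rule n) {a} → act r ≡ a → ⟦ actIs r a ⟧ ρ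
actIs-intro r {a} e with act r ≡ᵇ a | ≡⇒≡ᵇ (act r) a e
... | true | _ = tt

actIs-elim : ∀ {n ρ} (r : Rule n) {a} → ⟦ actIs r a ⟧ ρ → act r ≡ a
actIs-elim r {a} p with act r ≡ᵇ a | ≡ᵇ⇒≡ (act r) a
... | true  | e = e tt
... | false | _ = ⊥-elim p

-- The body of Path; T is the same disjunction with the action label fixed.
anyStep : ∀ {n} → BPP n → Vec Term n → Vec Term n → LIA
anyStep Δ s t = ⋁L Δ (λ r → enabled s r ∧' T⁻ s t r)

anyStep-complete : ∀ {n ρ} (Δ : BPP n) {s t σ τ b} → Denotes ρ s σ → Denotes ρ t τ
  → Step Δ σ b τ → ⟦ anyStep Δ s t ⟧ ρ
anyStep-complete Δ ds dt (r , r∈ , _ , en , refl) = ⋁L-intro Δ _ r∈ (fires-complete r ds dt en)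

anyStep-sound : ∀ {n ρ} (Δ : BPP n) {s t σ} → Denotes ρ s σ → ⟦ anyStep Δ s t ⟧ ρ
  → ∃₂ λ b τ → Step Δ σ b τ × Denotes ρ t τ
anyStep-sound Δ ds p with ⋁L-elim Δ _ p
... | r , r∈ , q with fires-sound r ds q
...   | en , dt = act r , _ , (r , r∈ , refl , en , refl) , dt

T-complete : ∀ {n ρ} (Δ : BPP n) {s t σ τ a} → Denotes ρ s σ → Denotes ρ t τ
  → Step Δ σ a τ → ⟦ T Δ s t a ⟧ ρ
T-complete Δ ds dt (r , r∈ , act≡ , en , refl) =
  ⋁L-intro Δ _ r∈ (actIs-intro r act≡ , fires-complete r ds dt en)

T-sound : ∀ {n ρ} (Δ : BPP n) {s t σ a} → Denotes ρ s σ → ⟦ T Δ s t a ⟧ ρ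
  → ∃ λ τ → Step Δ σ a τ × Denotes ρ t τ
T-sound Δ ds p with ⋁L-elim Δ _ p
... | r , r∈ , (act≡ , q) with fires-sound r ds q
...   | en , dt = _ , (r , r∈ , actIs-elim r act≡ , en , refl) , dt

E-correct : ∀ {n} (Δ : BPP n) k a φ c {ρ s σ} → StablyDenotes c ρ s σ
  → (∀ {ρ' t τ} → StablyDenotes (c + n) ρ' t τ → Sat Δ k τ φ ⇔ ⟦ Trans Δ φ t k (c + n) ⟧ ρ')
  → Sat Δ k σ (E⟨ a ⟩ φ) ⇔ ⟦ Trans Δ (E⟨ a ⟩ φ) s k c ⟧ ρ
E-correct {n} Δ k a φ c {ρ} {s} {σ} G IH = mk⇔ complete sound
  where
  idx : Fin n → ℕ
  idx i = c + toℕ i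

  bound : ∀ i → idx i < c + n
  bound i = ℕP.+-monoʳ-< c (toℕ<n i)

  complete : Sat Δ k σ (E⟨ a ⟩ φ) → ⟦ Trans Δ (E⟨ a ⟩ φ) s k c ⟧ ρ
  complete (1≤k , τ , step , sat) =
    ℤ.+≤+ 1≤k ,
    ∃*-block-intro c τ _ (T-complete Δ ds dt step , to (IH (vars-stable idx bound dt)) sat)
    where
    ds = G (assign-below ρ c τ)
    dt = denotes-vars idx (assign-lookup ρ c τ)

  sound : ⟦ Trans Δ (E⟨ a ⟩ φ) s k c ⟧ ρ → Sat Δ k σ (E⟨ a ⟩ φ)
  sound (k≥1 , p) with ∃*-block-elim c n _ p
  ... | ρ' , agree , (step , q) with T-sound Δ (G agree) step
  ...   | τ , st , dt = ℤP.drop‿+≤+ k≥1 , τ , st , from (IH (vars-stable idx bound dt)) q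

-- In the EG block, variable c + (j n + i) holds π j at X_i: this is entry combine j i of
-- concat (tabulate π).
layer-index : ∀ {m n} (j : Fin m) (i : Fin n) → toℕ j * n + toℕ i ≡ toℕ (combine j i)
layer-index {n = n} j i =
  trans (cong (λ x → x + toℕ i) (ℕP.*-comm (toℕ j) n)) (sym (toℕ-combine j i))

layer-bound : ∀ {m n} c (j : Fin m) (i : Fin n) → c + (toℕ j * n + toℕ i) < c + m * n
layer-bound c j i = ℕP.+-monoʳ-< c (subst (_< _) (sym (layer-index j i)) (toℕ<n (combine j i)))

assign-concat : ∀ {m n} ρ c (π : Fin m → State n) j i
  → assign ρ c (concat (tabulate π)) (c + (toℕ j * n + toℕ i)) ≡ + lookup (π j) i
assign-concat ρ c π j i = begin
  assign ρ c w (c + (toℕ j * _ + toℕ i))  ≡⟨ cong (λ x → assign ρ c w (c + x)) (layer-index j i) ⟩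
  assign ρ c w (c + toℕ (combine j i))    ≡⟨ assign-lookup ρ c w (combine j i) ⟩
  + lookup w (combine j i)                ≡⟨ cong +_ (lookup-concat (tabulate π) j i) ⟩
  + lookup (lookup (tabulate π) j) i      ≡⟨ cong (λ v → + lookup v i) (lookup∘tabulate π j) ⟩
  + lookup (π j) i                        ∎
  where
  open ≡-Reasoning
  w = concat (tabulate π)

EG-correct : ∀ {n} (Δ : BPP n) k φ c {ρ s σ} → StablyDenotes c ρ s σ
  → (∀ {ρ' t τ} → StablyDenotes (c + suc k * n) ρ' t τ
       → Sat Δ k τ φ ⇔ ⟦ Trans Δ φ t k (c + suc k * n) ⟧ ρ')
  → Sat Δ k σ (EG φ) ⇔ ⟦ Trans Δ (EG φ) s k c ⟧ ρ
EG-correct {n} Δ k φ c {ρ} {s} {σ} G IH = mk⇔ complete sound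
  where
  idx : Fin (suc k) → Fin n → ℕ
  idx j i = c + (toℕ j * n + toℕ i)

  u : Fin (suc k) → Vec Term n
  u j = vars (idx j)

  stable : ∀ {ρ'} j {τ} → Denotes ρ' (u j) τ → StablyDenotes (c + suc k * n) ρ' (u j) τ
  stable j = vars-stable (idx j) (layer-bound c j)

  complete : Sat Δ k σ (EG φ) → ⟦ Trans Δ (EG φ) s k c ⟧ ρ
  complete (π , π0 , steps , sats) = ∃*-block-intro c (concat (tabulate π)) _
    ( ⋀-intro _ (λ j → anyStep-complete Δ (du (inject₁ j)) (du (suc j)) (proj₂ (steps j)))
    , ⋀-intro _ (λ i → trans (value (du zero) i)
                         (trans (cong (λ v → + lookup v i) π0) (sym (value ds i))))
    , ⋀-intro _ (λ j → to (IH (stable j (du j))) (sats j)))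
    where
    ds = G (assign-below ρ c (concat (tabulate π)))
    du : ∀ j → Denotes (assign ρ c (concat (tabulate π))) (u j) (π j)
    du j = denotes-vars (idx j) (assign-concat ρ c π j)

  sound : ⟦ Trans Δ (EG φ) s k c ⟧ ρ → Sat Δ k σ (EG φ)
  sound p with ∃*-block-elim c (suc k * n) _ p
  ... | ρ' , agree , (path , init , sats) =
    π , sym (denotes⇒≡valueOf du0) , steps , λ j → from (IH (stable j (du j))) (sat j)
    where
    π : Fin (suc k) → State n
    π j = valueOf ρ' (u j)

    du0 : Denotes ρ' (u zero) σ
    du0 = denotes λ i → trans (⋀-elim _ init i) (value (G agree) i)

    sat : ∀ j → ⟦ Trans Δ φ (u j) k (c + suc k * n) ⟧ ρ'
    sat = ⋀-elim (λ j → Trans Δ φ (u j) k (c + suc k * n)) sats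

    stepAt : ∀ j {σj} → Denotes ρ' (u (inject₁ j)) σj
      → ∃₂ λ b τ → Step Δ σj b τ × Denotes ρ' (u (suc j)) τ
    stepAt j d = anyStep-sound Δ d (⋀-elim _ path j)

    du : ∀ j → Denotes ρ' (u j) (π j)
    du = <-weakInduction (λ j → Denotes ρ' (u j) (π j)) (denotes-valueOf du0)
           (λ j d → let (_ , _ , _ , d') = stepAt j d in denotes-valueOf d')

    steps : ∀ j → ∃ λ b → Step Δ (π (inject₁ j)) b (π (suc j))
    steps j with stepAt j (du (inject₁ j))
    ... | b , τ , st , d = b , subst (Step Δ (π (inject₁ j)) b) (denotes⇒≡valueOf d) st

Trans-correct : ∀ {n} (Δ : BPP n) k φ c {ρ s σ} → StablyDenotes c ρ s σ
  → Sat Δ k σ φ ⇔ ⟦ Trans Δ φ s k c ⟧ ρ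
Trans-correct Δ k (atom a b) c G = atom-correct Δ k a b c G
Trans-correct Δ k (¬ᴱ φ)     c G = ¬-cong-⇔ (Trans-correct Δ k φ c G)
Trans-correct Δ k (φ ∧ᴱ ψ)   c G = Trans-correct Δ k φ c G ×-⇔ Trans-correct Δ k ψ c G
Trans-correct {n} Δ k (E⟨ a ⟩ φ) c G = E-correct Δ k a φ c G (Trans-correct Δ k φ (c + n))
Trans-correct {n} Δ k (EG φ)     c G = EG-correct Δ k φ c G (Trans-correct Δ k φ (c + suc k * n))

theorem4 : ∀ {n : ℕ} (Δ : BPP n) (φ : EGForm n) (s : State n) (k : ℕ)
    → (Sat Δ k s φ → ⟦ Trans Δ φ (const s) k 0 ⟧ ρ₀)
    × (⟦ Trans Δ φ (const s) k 0 ⟧ ρ₀ → Sat Δ k s φ)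
theorem4 Δ φ s k = to correct , from correct
  where correct = Trans-correct Δ k φ 0 (const-denotes s)
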